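{- Over (finite) data words, the zeroary modalities $\mathsf S$ and $\mathsf P$ are definable in the $\nu$-fragment using only unary modalities: there are formulas $\psi_{\mathsf S},\psi_{\mathsf P}$ of the $\nu$-fragment in which neither $\mathsf S$ nor $\mathsf P$ occurs, such that on every data word $\psi_{\mathsf S}$ holds exactly at the positions where $\mathsf S$ holds and $\psi_{\mathsf P}$ holds exactly where $\mathsf P$ holds.
   Context: Data words: finite sequences $(a_1,d_1)\cdots(a_n,d_n)$ over $\Sigma\times\mathcal D$ ($\Sigma$ finite, $\mathcal D$ infinite); $i\sim j$ iff $d_i=d_j$; class successor/predecessor of $i$: least $j>i$ / greatest $j<i$ with $j\sim i$, if any. $\mu$-calculus: $\varphi::= x\mid A\mid\neg A\mid \mathsf M\varphi\mid\varphi\vee\varphi\mid\varphi\wedge\varphi\mid\mu x.\varphi\mid\nu x.\varphi$, atoms $A$: letters and $\mathsf S,\mathsf P,\mathsf{first}^g,\mathsf{last}^g,\mathsf{first}^c,\mathsf{last}^c$; unary modalities $\mathsf M\in\{\mathtt X^g,\mathtt X^c,\mathtt Y^g,\mathtt Y^c\}$ evaluating the argument at the successor, class successor, predecessor, class predecessor (false if nonexistent). $\mathsf{first}^g$/$\mathsf{last}^g$ hold at the first/last position; $\mathsf{first}^c$/$\mathsf{last}^c$ where there is no class predecessor/successor; $\mathsf S$ holds at $i$ iff $i$ is not last and $i+1$ is the class successor of $i$; $\mathsf P$ holds at $i$ iff $i\ne1$ and $i-1$ is the class predecessor of $i$; $\mu,\nu$ least/greatest fixpoints. The $\nu$-fragment: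 formulas in which $\mu$ does not occur. -}

module Defs where

open import Data.Nat using (ℕ; zero; suc; _<_; _≡ᵇ_)
open import Data.Fin using (Fin; toℕ)
open import Data.Bool using (Bool; true; false; if_then_else_)
open import Data.Product using (Σ; ∃; _×_; _,_; proj₁; proj₂)
open import Relation.Nullary using (¬_)
open import Relation.Binary.PropositionalEquality using (_≡_)

-- Data domain 𝒟 = ℕ (an infinite set; the semantics only uses equality of data).
-- A data word of length n over alphabet A: positions Fin n (0-indexed).
record DataWord (A : Set) : Set where
  field
    len    : ℕ
    letter : Fin len → A
    datum  : Fin len → ℕ
open DataWord public

module _ {A : Set} (w : DataWord A) where
  _∼_ : Fin (len w) → Fin (len w) → Set
  i ∼ j = datum w i ≡ datum w j

  IsClassSucc : Fin (len w) → Fin (len w) → Set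
  IsClassSucc i j = (toℕ i < toℕ j) × (j ∼ i)
    × ((k : Fin (len w)) → toℕ i < toℕ k → toℕ k < toℕ j → ¬ (k ∼ i))

  IsClassPred : Fin (len w) → Fin (len w) → Set
  IsClassPred i j = (toℕ j < toℕ i) × (j ∼ i)
    × ((k : Fin (len w)) → toℕ j < toℕ k → toℕ k < toℕ i → ¬ (k ∼ i))

  IsSucc : Fin (len w) → Fin (len w) → Set
  IsSucc i j = toℕ j ≡ suc (toℕ i)

  IsPred : Fin (len w) → Fin (len w) → Set
  IsPred i j = suc (toℕ j) ≡ toℕ i

data Atom (A : Set) : Set where
  letterA : A → Atom A
  S P firstᵍ lastᵍ firstᶜ lastᶜ : Atom A

data Mod : Set where
  Xᵍ Xᶜ Yᵍ Yᶜ : Mod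

Var : Set
Var = ℕ

data Formula (A : Set) : Set where
  var   : Var → Formula A
  pos   : Atom A → Formula A
  neg   : Atom A → Formula A
  mod   : Mod → Formula A → Formula A
  _∨ᶠ_  : Formula A → Formula A → Formula A
  _∧ᶠ_  : Formula A → Formula A → Formula A
  μᶠ    : Var → Formula A → Formula A
  νᶠ    : Var → Formula A → Formula A

data NoMu {A : Set} : Formula A → Set where
  var : ∀ x → NoMu (var x)
  pos : ∀ a → NoMu (pos a)
  neg : ∀ a → NoMu (neg a)
  mod : ∀ m {φ} → NoMu φ → NoMu (mod m φ)
  or  : ∀ {φ ψ} → NoMu φ → NoMu ψ → NoMu (φ ∨ᶠ ψ)
  and : ∀ {φ ψ} → NoMu φ → NoMu ψ → NoMu (φ ∧ᶠ ψ)
  nu  : ∀ x {φ} → NoMu φ → NoMu (νᶠ x φ)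

data NotSP {A : Set} : Atom A → Set where
  letterA : ∀ a → NotSP (letterA a)
  firstᵍ : NotSP firstᵍ
  lastᵍ  : NotSP lastᵍ
  firstᶜ : NotSP firstᶜ
  lastᶜ  : NotSP lastᶜ

data NoSP {A : Set} : Formula A → Set where
  var : ∀ x → NoSP (var x)
  pos : ∀ {a} → NotSP a → NoSP (pos a)
  neg : ∀ {a} → NotSP a → NoSP (neg a)
  mod : ∀ m {φ} → NoSP φ → NoSP (mod m φ)
  or  : ∀ {φ ψ} → NoSP φ → NoSP ψ → NoSP (φ ∨ᶠ ψ)
  and : ∀ {φ ψ} → NoSP φ → NoSP ψ → NoSP (φ ∧ᶠ ψ)
  mu  : ∀ x {φ} → NoSP φ → NoSP (μᶠ x φ)
  nu  : ∀ x {φ} → NoSP φ → NoSP (νᶠ x φ)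

module Semantics {A : Set} (w : DataWord A) where
  Pos : Set
  Pos = Fin (len w)

  Env : Set
  Env = Var → Pos → Bool

  _[_↦_] : Env → Var → (Pos → Bool) → Env
  (ρ [ x ↦ T ]) y = if x ≡ᵇ y then T else ρ y

  ⟦_⟧ᵃ : Atom A → Pos → Set
  ⟦ letterA a ⟧ᵃ i = letter w i ≡ a
  ⟦ S ⟧ᵃ i = Σ Pos λ j → IsSucc w i j × IsClassSucc w i j
  ⟦ P ⟧ᵃ i = Σ Pos λ j → IsPred w i j × IsClassPred w i j
  ⟦ firstᵍ ⟧ᵃ i = toℕ i ≡ 0
  ⟦ lastᵍ ⟧ᵃ i = suc (toℕ i) ≡ len w
  ⟦ firstᶜ ⟧ᵃ i = ¬ (Σ Pos λ j → IsClassPred w i j)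
  ⟦ lastᶜ ⟧ᵃ i = ¬ (Σ Pos λ j → IsClassSucc w i j)

  step : Mod → Pos → Pos → Set
  step Xᵍ = IsSucc w
  step Xᶜ = IsClassSucc w
  step Yᵍ = IsPred w
  step Yᶜ = IsClassPred w

  -- Fixpoints via Knaster–Tarski over subsets of the finite set of positions:
  -- lfp = intersection of all pre-fixed points, gfp = union of all post-fixed points.
  ⟦_⟧ : Formula A → Env → Pos → Set
  ⟦ var x ⟧ ρ i = ρ x i ≡ true
  ⟦ pos a ⟧ ρ i = ⟦ a ⟧ᵃ i
  ⟦ neg a ⟧ ρ i = ¬ ⟦ a ⟧ᵃ i
  ⟦ mod m φ ⟧ ρ i = Σ Pos λ j → step m i j × ⟦ φ ⟧ ρ j
  ⟦ φ ∨ᶠ ψ ⟧ ρ i = Data.Sum._⊎_ (⟦ φ ⟧ ρ i) (⟦ ψ ⟧ ρ i)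
    where import Data.Sum
  ⟦ φ ∧ᶠ ψ ⟧ ρ i = ⟦ φ ⟧ ρ i × ⟦ ψ ⟧ ρ i
  ⟦ μᶠ x φ ⟧ ρ i = (T : Pos → Bool)
    → ((j : Pos) → ⟦ φ ⟧ (ρ [ x ↦ T ]) j → T j ≡ true) → T i ≡ true
  ⟦ νᶠ x φ ⟧ ρ i = Σ (Pos → Bool) λ T
    → ((j : Pos) → T j ≡ true → ⟦ φ ⟧ (ρ [ x ↦ T ]) j) × (T i ≡ true)

_,_,_⊨_ : {A : Set} (w : DataWord A) → Semantics.Env w → Fin (len w) → Formula A → Set
w , ρ , i ⊨ φ = Semantics.⟦_⟧ w φ ρ i

-- A set T of positions is
-- a post-fixed point of the body of ψS iff every t ∈ T has a class successor
-- c whose (global) predecessor c - 1 again lies in T; dually for ψP.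
--
-- Completeness: if S holds at i then the singleton {i} is such a post-fixed
-- point (the class successor of i is i + 1, whose predecessor is i).
--
-- Soundness: let T be post-fixed and i ∈ T, with class successor c and
-- q = c - 1 ∈ T, so i ≤ q.  Either q = i and S holds at i, or i < q; then by
-- induction (downwards along the word, well-founded as the word is finite)
-- S holds at q, so c is also the class successor of q.  Since the class
-- successor map is injective, q = i after all.  The argument for P is the
-- mirror image, by upward induction and injectivity of class predecessors.
module Submission where

open import Defs
open import Data.Nat using (ℕ; suc; _≤_; s≤s⁻¹)
open import Data.Nat.Properties using (m≤n⇒m<n∨m≡n; suc-injective)
open import Data.Fin using (Fin; toℕ; _≟_; _<_; _>_)
open import Data.Fin.Properties using (toℕ-injective; <-cmp)
open import Data.Fin.Induction using (<-wellFounded; >-wellFounded; Acc; acc)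
open import Data.Product using (Σ; _×_; _,_; proj₁)
open import Data.Sum using (inj₁; inj₂)
open import Data.Bool using (Bool; true)
open import Relation.Binary.Definitions using (tri<; tri≈; tri>)
open import Relation.Nullary using (does; yes; no)
open import Relation.Nullary.Decidable using (dec-true)
open import Relation.Nullary.Negation using (contradiction)
open import Relation.Binary.PropositionalEquality
  using (_≡_; refl; sym; trans; cong; subst)

ψS ψP : {A : Set} → Formula A
ψS = νᶠ 0 (mod Xᶜ (mod Yᵍ (var 0)))
ψP = νᶠ 0 (mod Yᶜ (mod Xᵍ (var 0)))

ψS-noMu : {A : Set} → NoMu (ψS {A})
ψS-noMu = nu 0 (mod Xᶜ (mod Yᵍ (var 0)))

ψS-noSP : {A : Set} → NoSP (ψS {A})
ψS-noSP = nu 0 (mod Xᶜ (mod Yᵍ (var 0)))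

ψP-noMu : {A : Set} → NoMu (ψP {A})
ψP-noMu = nu 0 (mod Yᶜ (mod Xᵍ (var 0)))

ψP-noSP : {A : Set} → NoSP (ψP {A})
ψP-noSP = nu 0 (mod Yᶜ (mod Xᵍ (var 0)))

module _ {A : Set} (w : DataWord A) where
  open Semantics w using (Pos; ⟦_⟧ᵃ)

  only : Pos → Pos → Bool
  only i t = does (t ≟ i)

  only-self : (i : Pos) → only i i ≡ true
  only-self i = dec-true (i ≟ i) refl

  only-sound : (i t : Pos) → only i t ≡ true → t ≡ i
  only-sound i t h with t ≟ i
  ... | yes t≡i = t≡i
  only-sound i t () | no _

  -- Two positions with the same class successor coincide: if i < j, then
  -- j would lie strictly between i and its class successor in i's class.
  classSucc-injective : {i j c : Pos} →
    IsClassSucc w i c → IsClassSucc w j c → i ≡ j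
  classSucc-injective {i} {j} (i<c , c∼i , i-min) (j<c , c∼j , j-min) with <-cmp i j
  ... | tri< i<j _ _ = contradiction (trans (sym c∼j) c∼i) (i-min j i<j j<c)
  ... | tri≈ _ i≡j _ = i≡j
  ... | tri> _ _ j<i = contradiction (trans (sym c∼i) c∼j) (j-min i j<i i<c)

  classPred-injective : {i j c : Pos} →
    IsClassPred w i c → IsClassPred w j c → i ≡ j
  classPred-injective {i} {j} (c<i , c∼i , i-min) (c<j , c∼j , j-min) with <-cmp i j
  ... | tri< i<j _ _ = contradiction (trans (sym c∼i) c∼j) (j-min i c<i i<j)
  ... | tri≈ _ i≡j _ = i≡j
  ... | tri> _ _ j<i = contradiction (trans (sym c∼j) c∼i) (i-min j c<j j<i)

  -- T is a post-fixed point of the body Xᶜ Yᵍ x of ψS (definitionally the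
  -- condition in the semantics of ν).
  SClosed : (Pos → Bool) → Set
  SClosed T = (t : Pos) → T t ≡ true →
    Σ Pos λ c → IsClassSucc w t c × Σ Pos λ q → IsPred w c q × T q ≡ true

  PClosed : (Pos → Bool) → Set
  PClosed T = (t : Pos) → T t ≡ true →
    Σ Pos λ c → IsClassPred w t c × Σ Pos λ q → IsSucc w c q × T q ≡ true

  SClosed-sound : (T : Pos → Bool) → SClosed T →
    (i : Pos) → Acc _>_ i → T i ≡ true → ⟦ S ⟧ᵃ i
  SClosed-sound T closed i (acc below) Ti with closed i Ti
  ... | c , i↝c , q , q+1≡c , Tq = c , c≡i+1 , i↝c
    where
      i≤q : toℕ i ≤ toℕ q
      i≤q = s≤s⁻¹ (subst (suc (toℕ i) ≤_) (sym q+1≡c) (proj₁ i↝c))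

      q≡i : q ≡ i
      q≡i with m≤n⇒m<n∨m≡n i≤q
      ... | inj₂ i≡q = sym (toℕ-injective i≡q)
      ... | inj₁ i<q with SClosed-sound T closed q (below i<q) Tq
      ...   | c′ , c′≡q+1 , q↝c′ = classSucc-injective q↝c i↝c
        where
          q↝c : IsClassSucc w q c
          q↝c = subst (IsClassSucc w q) (toℕ-injective (trans c′≡q+1 q+1≡c)) q↝c′

      c≡i+1 : IsSucc w i c
      c≡i+1 = trans (sym q+1≡c) (cong (λ p → suc (toℕ p)) q≡i)

  PClosed-sound : (T : Pos → Bool) → PClosed T →
    (p : Pos) → Acc _<_ p → T p ≡ true → ⟦ P ⟧ᵃ p
  PClosed-sound T closed p (acc below) Tp with closed p Tp
  ... | c , p↝c , q , q≡c+1 , Tq = c , c+1≡p , p↝c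
    where
      q≤p : toℕ q ≤ toℕ p
      q≤p = subst (_≤ toℕ p) (sym q≡c+1) (proj₁ p↝c)

      q≡p : q ≡ p
      q≡p with m≤n⇒m<n∨m≡n q≤p
      ... | inj₂ q≡p = toℕ-injective q≡p
      ... | inj₁ q<p with PClosed-sound T closed q (below q<p) Tq
      ...   | c′ , c′+1≡q , q↝c′ = classPred-injective q↝c p↝c
        where
          q↝c : IsClassPred w q c
          q↝c = subst (IsClassPred w q) (toℕ-injective (suc-injective (trans c′+1≡q q≡c+1))) q↝c′

      c+1≡p : IsPred w p c
      c+1≡p = trans (sym q≡c+1) (cong toℕ q≡p)

  only-SClosed : (i : Pos) → ⟦ S ⟧ᵃ i → SClosed (only i)
  only-SClosed i (c , c≡i+1 , i↝c) t t∈only-i with only-sound i t t∈only-i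
  ... | refl = c , i↝c , i , sym c≡i+1 , only-self i

  only-PClosed : (p : Pos) → ⟦ P ⟧ᵃ p → PClosed (only p)
  only-PClosed p (c , c+1≡p , p↝c) t t∈only-p with only-sound p t t∈only-p
  ... | refl = c , p↝c , p , sym c+1≡p , only-self p

  ψS-defines-S : (ρ : Semantics.Env w) (i : Pos) →
    (w , ρ , i ⊨ ψS → w , ρ , i ⊨ pos S) × (w , ρ , i ⊨ pos S → w , ρ , i ⊨ ψS)
  ψS-defines-S ρ i =
      (λ { (T , closed , Ti) → SClosed-sound T closed i (>-wellFounded i) Ti })
    , (λ Si → only i , only-SClosed i Si , only-self i)

  ψP-defines-P : (ρ : Semantics.Env w) (i : Pos) →
    (w , ρ , i ⊨ ψP → w , ρ , i ⊨ pos P) × (w , ρ , i ⊨ pos P → w , ρ , i ⊨ ψP)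
  ψP-defines-P ρ i =
      (λ { (T , closed , Ti) → PClosed-sound T closed i (<-wellFounded i) Ti })
    , (λ Pi → only i , only-PClosed i Pi , only-self i)

proposition1 : (k : ℕ) → Σ (Formula (Fin k)) λ ψS → Σ (Formula (Fin k)) λ ψP →
    NoMu ψS × NoSP ψS × NoMu ψP × NoSP ψP
    × ((w : DataWord (Fin k)) (ρ : Semantics.Env w) (i : Fin (len w)) →
    ((w , ρ , i ⊨ ψS → w , ρ , i ⊨ pos S) × (w , ρ , i ⊨ pos S → w , ρ , i ⊨ ψS))
    × ((w , ρ , i ⊨ ψP → w , ρ , i ⊨ pos P) × (w , ρ , i ⊨ pos P → w , ρ , i ⊨ ψP)))
proposition1 k = ψS , ψP , ψS-noMu , ψS-noSP , ψP-noMu , ψP-noSP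
  , λ w ρ i → ψS-defines-S w ρ i , ψP-defines-P w ρ i
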